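{- For every $N\ge0$, $\dim_{\mathbb Q}W_N=\left\lfloor\frac{N+2}{3}\right\rfloor$.
   Context: $W_N\subset\mathbb Q[X,Y]$ denotes the subspace of homogeneous polynomials $P$ of degree $N$ satisfying $P(X,Y)+P(Y,X)=0$ and $P(X,Y)+P(Y,-X-Y)+P(-X-Y,X)=0$. -}

module Defs where

open import Data.Nat as ℕ using (ℕ; zero; suc; _∸_; _<?_)
open import Data.Fin using (Fin; zero; suc; fromℕ<)
open import Data.Rational using (ℚ; 0ℚ; 1ℚ; _+_; _*_; -_)
open import Data.Product using (Σ; _×_)
open import Relation.Binary.PropositionalEquality using (_≡_)
open import Relation.Nullary using (yes; no)

sumTo : ℕ → (ℕ → ℚ) → ℚ
sumTo zero    f = 0ℚ
sumTo (suc n) f = f zero + sumTo n (λ i → f (suc i))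

sumFin : ∀ {d} → (Fin d → ℚ) → ℚ
sumFin {zero}  f = 0ℚ
sumFin {suc d} f = f zero + sumFin (λ i → f (suc i))

-- A sequence  a : ℕ → ℚ  (finitely supported) together with a degree n
-- stands for  Σ_i a i · X^i Y^(n-i).  Multiplication of forms is the
-- convolution of coefficient sequences (degrees add).

Coeffs : Set
Coeffs = ℕ → ℚ

conv : Coeffs → Coeffs → Coeffs
conv f g k = sumTo (suc k) (λ i → f i * g (k ∸ i))

one : Coeffs
one zero    = 1ℚ
one (suc _) = 0ℚ

-- the linear form  a X + b Y  (degree 1)
linear : ℚ → ℚ → Coeffs
linear a b zero          = b
linear a b (suc zero)    = a
linear a b (suc (suc _)) = 0ℚ

pow : Coeffs → ℕ → Coeffs
pow L zero    = one
pow L (suc k) = conv L (pow L k)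

-- Homogeneous polynomials of degree N over ℚ:
-- P = Σ_{i ≤ N} P i · X^i Y^(N-i).
Form : ℕ → Set
Form N = Fin (suc N) → ℚ

coeff : ∀ {N} → Form N → Coeffs
coeff {N} P i with i <? suc N
... | yes p = P (fromℕ< p)
... | no  _ = 0ℚ

-- substitution  P(L₁, L₂)  of linear forms L₁, L₂ for X, Y;
-- result is the coefficient sequence of a form of degree N
subst : ∀ {N} → Form N → Coeffs → Coeffs → Coeffs
subst {N} P L₁ L₂ k =
  sumTo (suc N) (λ i → coeff P i * conv (pow L₁ i) (pow L₂ (N ∸ i)) k)

X Y XY⁻ : Coeffs
X   = linear 1ℚ 0ℚ
Y   = linear 0ℚ 1ℚ
XY⁻ = linear (- 1ℚ) (- 1ℚ)

InW : (N : ℕ) → Form N → Set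
InW N P =
  (∀ k → subst P X Y k + subst P Y X k ≡ 0ℚ) ×
  (∀ k → subst P X Y k + subst P Y XY⁻ k + subst P XY⁻ X k ≡ 0ℚ)

linComb : ∀ {N d} → (Fin d → ℚ) → (Fin d → Form N) → Form N
linComb a v j = sumFin (λ i → a i * v i j)

LinIndep : ∀ {N d} → (Fin d → Form N) → Set
LinIndep v = ∀ a → (∀ j → linComb a v j ≡ 0ℚ) → ∀ i → a i ≡ 0ℚ

Spans : ∀ {N d} → (Form N → Set) → (Fin d → Form N) → Set
Spans W v = ∀ P → W P → Σ _ (λ a → ∀ j → P j ≡ linComb a v j)

IsBasis : ∀ {N d} → (Form N → Set) → (Fin d → Form N) → Set
IsBasis W v = (∀ i → W (v i)) × LinIndep v × Spans W v

HasDim : ∀ {N} → (Form N → Set) → ℕ → Set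
HasDim {N} W d = Σ (Fin d → Form N) (λ v → IsBasis W v)

module Submission where

-- Each of the four substitutions (X,Y) ↦ (X,Y), (Y,X), (Y,Z), (Z,X) occurring in the
-- relations satisfies L₁L₂(L₁+L₂) = XY(X+Y), so it carries XYZ·Q to XYZ·Q(L₁,L₂); hence
-- multiplication by XYZ maps W_n into W_(n+3), and back since it is injective.  Conversely,
-- reading off extreme coefficients of the relations shows that P ∈ W_N without X^N term has no
-- Y^N term and vanishes at (1,-1), so it is divisible by X, Y and X+Y, i.e. by XYZ.  Thus the
-- section {P ∈ W_N : P has no X^N term} is XYZ·W_(N-3) for N ≥ 3 and 0 for N = 1, 2, while
-- X^N - Y^N ∈ W_N has leading coefficient 1: dim W_N = 1 + dim W_(N-3), and dim W_0 = 0.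

open import Defs

module DimensionOfW where

  open import Data.Nat as ℕ using (ℕ; zero; suc; _∸_; _<?_; z≤n; s≤s)
    renaming (_<_ to _<ℕ_; _≤_ to _≤ℕ_)
  import Data.Nat.Properties as ℕP
  import Data.Nat.DivMod as ℕDivMod
  open import Data.Fin using (Fin; zero; suc; fromℕ<; toℕ; fromℕ)
  import Data.Fin.Properties as FinP
  open import Data.Rational using (ℚ; 0ℚ; 1ℚ; _+_; _*_; -_; ½)
  import Data.Rational.Properties as ℚP
  open import Data.Rational.Solver using (module +-*-Solver)
  open import Data.Product using (Σ; _×_; _,_; proj₁; proj₂)
  open import Data.Sum using (inj₁; inj₂)
  open import Data.Empty using (⊥-elim)
  open import Data.Vec.Functional using (_∷_)
  open import Relation.Nullary using (yes; no)
  open import Relation.Binary.PropositionalEquality hiding (subst)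
  open +-*-Solver

  sumTo-cong< : ∀ n {f g : ℕ → ℚ} → (∀ i → i <ℕ n → f i ≡ g i) → sumTo n f ≡ sumTo n g
  sumTo-cong< zero    h = refl
  sumTo-cong< (suc n) h = cong₂ _+_ (h zero (s≤s z≤n)) (sumTo-cong< n (λ i i<n → h (suc i) (s≤s i<n)))

  sumTo-cong : ∀ n {f g : ℕ → ℚ} → (∀ i → f i ≡ g i) → sumTo n f ≡ sumTo n g
  sumTo-cong n h = sumTo-cong< n (λ i _ → h i)

  sumTo-zero : ∀ n {f : ℕ → ℚ} → (∀ i → f i ≡ 0ℚ) → sumTo n f ≡ 0ℚ
  sumTo-zero zero    h = refl
  sumTo-zero (suc n) h = cong₂ _+_ (h zero) (sumTo-zero n (λ i → h (suc i)))

  sumTo-add : ∀ n (f g : ℕ → ℚ) → sumTo n (λ i → f i + g i) ≡ sumTo n f + sumTo n g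
  sumTo-add zero    f g = refl
  sumTo-add (suc n) f g = begin
    (f 0 + g 0) + sumTo n (λ i → f (suc i) + g (suc i))
      ≡⟨ cong ((f 0 + g 0) +_) (sumTo-add n _ _) ⟩
    (f 0 + g 0) + (sumTo n (λ i → f (suc i)) + sumTo n (λ i → g (suc i)))
      ≡⟨ solve 4 (λ a b c d → (a :+ b) :+ (c :+ d) := (a :+ c) :+ (b :+ d)) refl (f 0) (g 0) _ _ ⟩
    (f 0 + sumTo n (λ i → f (suc i))) + (g 0 + sumTo n (λ i → g (suc i))) ∎
    where open ≡-Reasoning

  sumTo-scale : ∀ n (r : ℚ) (f : ℕ → ℚ) → sumTo n (λ i → r * f i) ≡ r * sumTo n f
  sumTo-scale zero    r f = sym (ℚP.*-zeroʳ r)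
  sumTo-scale (suc n) r f = begin
    r * f 0 + sumTo n (λ i → r * f (suc i)) ≡⟨ cong (r * f 0 +_) (sumTo-scale n r _) ⟩
    r * f 0 + r * sumTo n (λ i → f (suc i)) ≡⟨ sym (ℚP.*-distribˡ-+ r (f 0) _) ⟩
    r * (f 0 + sumTo n (λ i → f (suc i)))   ∎
    where open ≡-Reasoning

  sumTo-lin : ∀ n (r s : ℚ) (f g : ℕ → ℚ) →
    sumTo n (λ i → r * f i + s * g i) ≡ r * sumTo n f + s * sumTo n g
  sumTo-lin n r s f g = trans (sumTo-add n _ _) (cong₂ _+_ (sumTo-scale n r f) (sumTo-scale n s g))

  sumTo-last : ∀ n (f : ℕ → ℚ) → sumTo (suc n) f ≡ sumTo n f + f n
  sumTo-last zero    f = ℚP.+-comm (f 0) 0ℚ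
  sumTo-last (suc n) f = begin
    f 0 + sumTo (suc n) (λ i → f (suc i))         ≡⟨ cong (f 0 +_) (sumTo-last n _) ⟩
    f 0 + (sumTo n (λ i → f (suc i)) + f (suc n)) ≡⟨ sym (ℚP.+-assoc (f 0) _ _) ⟩
    (f 0 + sumTo n (λ i → f (suc i))) + f (suc n) ∎
    where open ≡-Reasoning

  sumFin-zero : ∀ {d} (f : Fin d → ℚ) → (∀ i → f i ≡ 0ℚ) → sumFin f ≡ 0ℚ
  sumFin-zero {zero}  f h = refl
  sumFin-zero {suc d} f h = cong₂ _+_ (h zero) (sumFin-zero (λ i → f (suc i)) (λ i → h (suc i)))

  infix 4 _≐_
  _≐_ : Coeffs → Coeffs → Set
  F ≐ G = ∀ k → F k ≡ G k

  -- If F holds the coefficients of a form of degree n, then F read in degree n+1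
  -- is Y·F, and  shift F  is X·F.
  shift : Coeffs → Coeffs
  shift F zero    = 0ℚ
  shift F (suc k) = F k

  shift-cong : ∀ {F G} → F ≐ G → shift F ≐ shift G
  shift-cong h zero    = refl
  shift-cong h (suc k) = h k

  mulLin : ℚ → ℚ → Coeffs → Coeffs
  mulLin a b F k = b * F k + a * shift F k

  mulLin-cong : ∀ a b {F G} → F ≐ G → mulLin a b F ≐ mulLin a b G
  mulLin-cong a b h k = cong₂ (λ x y → b * x + a * y) (h k) (shift-cong h k)

  shift-mulLin : ∀ a b F → shift (mulLin a b F) ≐ mulLin a b (shift F)
  shift-mulLin a b F zero    = sym (solve 2 (λ a b → b :* con 0ℚ :+ a :* con 0ℚ := con 0ℚ) refl a b)
  shift-mulLin a b F (suc k) = refl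

  conv-linear : ∀ a b F → conv (linear a b) F ≐ mulLin a b F
  conv-linear a b F zero    = cong (b * F 0 +_) (sym (ℚP.*-zeroʳ a))
  conv-linear a b F (suc k) = begin
    b * F (suc k) + (a * F k + sumTo k (λ i → 0ℚ * F (k ∸ suc i)))
      ≡⟨ cong (λ z → b * F (suc k) + (a * F k + z)) (sumTo-zero k (λ i → ℚP.*-zeroˡ (F (k ∸ suc i)))) ⟩
    b * F (suc k) + (a * F k + 0ℚ)
      ≡⟨ cong (b * F (suc k) +_) (ℚP.+-identityʳ _) ⟩
    b * F (suc k) + a * F k ∎
    where open ≡-Reasoning

  conv-oneˡ : ∀ F → conv one F ≐ F
  conv-oneˡ F zero    = trans (ℚP.+-identityʳ _) (ℚP.*-identityˡ (F 0))
  conv-oneˡ F (suc k) = begin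
    1ℚ * F (suc k) + sumTo (suc k) (λ i → 0ℚ * F (k ∸ i))
      ≡⟨ cong₂ _+_ (ℚP.*-identityˡ (F (suc k))) (sumTo-zero (suc k) (λ i → ℚP.*-zeroˡ (F (k ∸ i)))) ⟩
    F (suc k) + 0ℚ
      ≡⟨ ℚP.+-identityʳ (F (suc k)) ⟩
    F (suc k) ∎
    where open ≡-Reasoning

  conv-mulLinˡ : ∀ a b A B → conv (conv (linear a b) A) B ≐ mulLin a b (conv A B)
  conv-mulLinˡ a b A B k = begin
    sumTo (suc k) (λ i → conv (linear a b) A i * B (k ∸ i))
      ≡⟨ sumTo-cong (suc k) (λ i → trans (cong (_* B (k ∸ i)) (conv-linear a b A i))
           (ℚP.*-distribʳ-+ (B (k ∸ i)) (b * A i) (a * shift A i))) ⟩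
    sumTo (suc k) (λ i → (b * A i) * B (k ∸ i) + (a * shift A i) * B (k ∸ i))
      ≡⟨ sumTo-cong (suc k) (λ i → cong₂ _+_ (ℚP.*-assoc b (A i) (B (k ∸ i))) (ℚP.*-assoc a (shift A i) (B (k ∸ i)))) ⟩
    sumTo (suc k) (λ i → b * (A i * B (k ∸ i)) + a * (shift A i * B (k ∸ i)))
      ≡⟨ sumTo-lin (suc k) b a (λ i → A i * B (k ∸ i)) (λ i → shift A i * B (k ∸ i)) ⟩
    b * conv A B k + a * sumTo (suc k) (λ i → shift A i * B (k ∸ i))
      ≡⟨ cong (λ z → b * conv A B k + a * z) (shifted k) ⟩
    b * conv A B k + a * shift (conv A B) k ∎
    where
    open ≡-Reasoning
    shifted : ∀ k → sumTo (suc k) (λ i → shift A i * B (k ∸ i)) ≡ shift (conv A B) k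
    shifted zero    = trans (ℚP.+-identityʳ _) (ℚP.*-zeroˡ (B 0))
    shifted (suc k) = trans (cong (_+ conv A B k) (ℚP.*-zeroˡ (B (suc k)))) (ℚP.+-identityˡ _)

  conv-mulLinʳ : ∀ a b A B → conv A (conv (linear a b) B) ≐ mulLin a b (conv A B)
  conv-mulLinʳ a b A B k = begin
    sumTo (suc k) (λ i → A i * conv (linear a b) B (k ∸ i))
      ≡⟨ sumTo-cong (suc k) (λ i → trans (cong (A i *_) (conv-linear a b B (k ∸ i)))
           (solve 5 (λ z b x a y → z :* (b :* x :+ a :* y) := b :* (z :* x) :+ a :* (z :* y))
                  refl (A i) b (B (k ∸ i)) a (shift B (k ∸ i)))) ⟩
    sumTo (suc k) (λ i → b * (A i * B (k ∸ i)) + a * (A i * shift B (k ∸ i)))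
      ≡⟨ sumTo-lin (suc k) b a (λ i → A i * B (k ∸ i)) (λ i → A i * shift B (k ∸ i)) ⟩
    b * conv A B k + a * sumTo (suc k) (λ i → A i * shift B (k ∸ i))
      ≡⟨ cong (λ z → b * conv A B k + a * z) (shifted k) ⟩
    b * conv A B k + a * shift (conv A B) k ∎
    where
    open ≡-Reasoning
    shifted : ∀ k → sumTo (suc k) (λ i → A i * shift B (k ∸ i)) ≡ shift (conv A B) k
    shifted zero    = trans (ℚP.+-identityʳ _) (ℚP.*-zeroʳ (A 0))
    shifted (suc k) = begin
      sumTo (suc (suc k)) (λ i → A i * shift B (suc k ∸ i))
        ≡⟨ sumTo-last (suc k) (λ i → A i * shift B (suc k ∸ i)) ⟩
      sumTo (suc k) (λ i → A i * shift B (suc k ∸ i)) + A (suc k) * shift B (suc k ∸ suc k)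
        ≡⟨ cong₂ _+_ (sumTo-cong< (suc k) (λ i i<sk → cong (λ m → A i * shift B m) (ℕP.+-∸-assoc 1 (ℕP.≤-pred i<sk))))
                     (trans (cong (λ m → A (suc k) * shift B m) (ℕP.n∸n≡0 k)) (ℚP.*-zeroʳ (A (suc k)))) ⟩
      conv A B k + 0ℚ
        ≡⟨ ℚP.+-identityʳ _ ⟩
      conv A B k ∎

  Supported : Coeffs → ℕ → Set
  Supported F n = ∀ i → n <ℕ i → F i ≡ 0ℚ

  power : ℚ → ℕ → ℚ
  power a zero    = 1ℚ
  power a (suc m) = a * power a m

  power-one : ∀ m → power 1ℚ m ≡ 1ℚ
  power-one zero    = refl
  power-one (suc m) = trans (ℚP.*-identityˡ _) (power-one m)

  mulLin-supported : ∀ a b {F} m → Supported F m → Supported (mulLin a b F) (suc m)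
  mulLin-supported a b {F} m F≤m (suc k) (s≤s m<k) =
    trans (cong₂ (λ x y → b * x + a * y) (F≤m (suc k) (ℕP.m<n⇒m<1+n m<k)) (F≤m k m<k))
          (solve 2 (λ a b → b :* con 0ℚ :+ a :* con 0ℚ := con 0ℚ) refl a b)

  mulLin-top : ∀ a b {F} m → Supported F m → mulLin a b F (suc m) ≡ a * F m
  mulLin-top a b {F} m F≤m = trans (cong (λ x → b * x + a * F m) (F≤m (suc m) (ℕP.n<1+n m)))
                                   (solve 2 (λ b y → b :* con 0ℚ :+ y := y) refl b (a * F m))

  mulLin-bottom : ∀ a b F → mulLin a b F 0 ≡ b * F 0
  mulLin-bottom a b F = solve 3 (λ a b x → b :* x :+ a :* con 0ℚ := b :* x) refl a b (F 0)

  pow-supported : ∀ a b m → Supported (pow (linear a b) m) m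
  pow-supported a b zero    (suc k) _   = refl
  pow-supported a b (suc m) k       m<k =
    trans (conv-linear a b (pow (linear a b) m) k) (mulLin-supported a b m (pow-supported a b m) k m<k)

  pow-top : ∀ a b m → pow (linear a b) m m ≡ power a m
  pow-top a b zero    = refl
  pow-top a b (suc m) = trans (conv-linear a b (pow (linear a b) m) (suc m))
    (trans (mulLin-top a b m (pow-supported a b m)) (cong (a *_) (pow-top a b m)))

  pow-bottom : ∀ a b m → pow (linear a b) m 0 ≡ power b m
  pow-bottom a b zero    = refl
  pow-bottom a b (suc m) = trans (conv-linear a b (pow (linear a b) m) 0)
    (trans (mulLin-bottom a b (pow (linear a b) m)) (cong (b *_) (pow-bottom a b m)))

  -- Multiplication by  XYZ = -(XY² + X²Y)  where  Z = -X-Y;  it raises the degree by 3.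
  mulXYZ : Coeffs → Coeffs
  mulXYZ F k = - (shift F k + shift (shift F) k)

  mulXYZ-cong : ∀ {F G} → F ≐ G → mulXYZ F ≐ mulXYZ G
  mulXYZ-cong h k = cong₂ (λ x y → - (x + y)) (shift-cong h k) (shift-cong (shift-cong h) k)

  mulXYZ-lin : ∀ r F G k → mulXYZ (λ i → r * F i + G i) k ≡ r * mulXYZ F k + mulXYZ G k
  mulXYZ-lin r F G zero          = sym (trans (cong (_+ 0ℚ) (ℚP.*-zeroʳ r)) (ℚP.+-identityʳ 0ℚ))
  mulXYZ-lin r F G (suc zero)    =
    solve 3 (λ r f g → :- ((r :* f :+ g) :+ con 0ℚ) := r :* :- (f :+ con 0ℚ) :+ :- (g :+ con 0ℚ)) refl r (F 0) (G 0)
  mulXYZ-lin r F G (suc (suc k)) =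
    solve 5 (λ r f f′ g g′ → :- ((r :* f :+ g) :+ (r :* f′ :+ g′)) := r :* :- (f :+ f′) :+ :- (g :+ g′))
          refl r (F (suc k)) (F k) (G (suc k)) (G k)

  mulXYZ-add : ∀ F G k → mulXYZ (λ i → F i + G i) k ≡ mulXYZ F k + mulXYZ G k
  mulXYZ-add F G k = trans (mulXYZ-cong (λ i → cong (_+ G i) (sym (ℚP.*-identityˡ (F i)))) k)
                           (trans (mulXYZ-lin 1ℚ F G k) (cong (_+ mulXYZ G k) (ℚP.*-identityˡ (mulXYZ F k))))

  mulXYZ-zero : ∀ {F} → F ≐ (λ _ → 0ℚ) → mulXYZ F ≐ (λ _ → 0ℚ)
  mulXYZ-zero h k = trans (mulXYZ-cong h k) (zeroCase k)
    where
    zeroCase : ∀ k → mulXYZ (λ _ → 0ℚ) k ≡ 0ℚ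
    zeroCase zero          = refl
    zeroCase (suc zero)    = refl
    zeroCase (suc (suc k)) = refl

  -- Multiplication by XYZ is injective: the coefficients of F are recovered one by one from the bottom.
  mulXYZ-injective : ∀ {F} → mulXYZ F ≐ (λ _ → 0ℚ) → F ≐ (λ _ → 0ℚ)
  mulXYZ-injective {F} h zero    = negZero (F 0) (h 1)
    where
    negZero : ∀ x → - (x + 0ℚ) ≡ 0ℚ → x ≡ 0ℚ
    negZero x e = trans (solve 1 (λ x → x := :- (:- (x :+ con 0ℚ))) refl x) (cong -_ e)
  mulXYZ-injective {F} h (suc k) =
    trans (solve 2 (λ x y → x := :- (:- (x :+ y)) :+ :- y) refl (F (suc k)) (F k))
          (cong₂ (λ a b → - a + - b) (h (suc (suc k))) (mulXYZ-injective h k))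

  mulXYZ-supported : ∀ n F → Supported F n → Supported (mulXYZ F) (3 ℕ.+ n)
  mulXYZ-supported n F h (suc (suc i)) (s≤s (s≤s n+1<i)) =
    cong₂ (λ x y → - (x + y)) (h (suc i) (ℕP.<-trans (ℕP.n<1+n n) (ℕP.m<n⇒m<1+n n+1<i)))
                              (h i (ℕP.<-trans (ℕP.n<1+n n) n+1<i))

  -- the X^(n+3) coefficient of XYZ·F vanishes, as XYZ has no X³ term
  mulXYZ-top : ∀ n F → Supported F n → mulXYZ F (3 ℕ.+ n) ≡ 0ℚ
  mulXYZ-top n F h = cong₂ (λ x y → - (x + y)) (h (2 ℕ.+ n) (ℕP.m<n⇒m<1+n (ℕP.n<1+n n))) (h (suc n) (ℕP.n<1+n n))

  record Cubic : Set where
    constructor cubic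
    field y³ xy² x²y x³ : ℚ

  _⊕_ : Cubic → Cubic → Cubic
  cubic a b c d ⊕ cubic a′ b′ c′ d′ = cubic (a + a′) (b + b′) (c + c′) (d + d′)

  mulCubic : Cubic → Coeffs → Coeffs
  mulCubic (cubic a b c d) F k = a * F k + b * shift F k + c * shift (shift F) k + d * shift (shift (shift F)) k

  mulCubic-⊕ : ∀ C D F k → mulCubic (C ⊕ D) F k ≡ mulCubic C F k + mulCubic D F k
  mulCubic-⊕ (cubic a b c d) (cubic a′ b′ c′ d′) F k =
    solve 12 (λ a b c d a′ b′ c′ d′ f s t u →
                (a :+ a′) :* f :+ (b :+ b′) :* s :+ (c :+ c′) :* t :+ (d :+ d′) :* u
             := (a :* f :+ b :* s :+ c :* t :+ d :* u) :+ (a′ :* f :+ b′ :* s :+ c′ :* t :+ d′ :* u))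
      refl a b c d a′ b′ c′ d′ (F k) (shift F k) (shift (shift F) k) (shift (shift (shift F)) k)

  lin³ : ℚ → ℚ → ℚ → ℚ → ℚ → ℚ → Cubic
  lin³ a₁ b₁ a₂ b₂ a₃ b₃ = cubic (b₁ * b₂ * b₃) (a₁ * b₂ * b₃ + b₁ * a₂ * b₃ + b₁ * b₂ * a₃)
                                 (a₁ * a₂ * b₃ + a₁ * b₂ * a₃ + b₁ * a₂ * a₃) (a₁ * a₂ * a₃)

  mulLin³ : ∀ a₁ b₁ a₂ b₂ a₃ b₃ F k →
    mulLin a₁ b₁ (mulLin a₂ b₂ (mulLin a₃ b₃ F)) k ≡ mulCubic (lin³ a₁ b₁ a₂ b₂ a₃ b₃) F k
  mulLin³ a₁ b₁ a₂ b₂ a₃ b₃ F k = begin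
    b₁ * G k + a₁ * shift G k
      ≡⟨ cong (λ z → b₁ * G k + a₁ * z) (shift-mulLin a₂ b₂ H k) ⟩
    b₁ * (b₂ * H k + a₂ * shift H k) + a₁ * (b₂ * shift H k + a₂ * shift (shift H) k)
      ≡⟨ cong₂ (λ x y → b₁ * (b₂ * H k + a₂ * x) + a₁ * (b₂ * x + a₂ * y)) (shift-mulLin a₃ b₃ F k) shift²H ⟩
    b₁ * (b₂ * (b₃ * f + a₃ * s) + a₂ * (b₃ * s + a₃ * t))
      + a₁ * (b₂ * (b₃ * s + a₃ * t) + a₂ * (b₃ * t + a₃ * u))
      ≡⟨ solve 10 (λ a₁ b₁ a₂ b₂ a₃ b₃ f s t u →
           b₁ :* (b₂ :* (b₃ :* f :+ a₃ :* s) :+ a₂ :* (b₃ :* s :+ a₃ :* t))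
             :+ a₁ :* (b₂ :* (b₃ :* s :+ a₃ :* t) :+ a₂ :* (b₃ :* t :+ a₃ :* u))
           := b₁ :* b₂ :* b₃ :* f :+ (a₁ :* b₂ :* b₃ :+ b₁ :* a₂ :* b₃ :+ b₁ :* b₂ :* a₃) :* s
              :+ (a₁ :* a₂ :* b₃ :+ a₁ :* b₂ :* a₃ :+ b₁ :* a₂ :* a₃) :* t :+ a₁ :* a₂ :* a₃ :* u)
           refl a₁ b₁ a₂ b₂ a₃ b₃ f s t u ⟩
    mulCubic (lin³ a₁ b₁ a₂ b₂ a₃ b₃) F k ∎
    where
    open ≡-Reasoning
    H G : Coeffs
    H = mulLin a₃ b₃ F
    G = mulLin a₂ b₂ H
    f s t u : ℚ
    f = F k
    s = shift F k
    t = shift (shift F) k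
    u = shift (shift (shift F)) k
    shift²H : shift (shift H) k ≡ mulLin a₃ b₃ (shift (shift F)) k
    shift²H = trans (shift-cong (shift-mulLin a₃ b₃ F) k) (shift-mulLin a₃ b₃ (shift F) k)

  -- If  L₁L₂(L₁ + L₂) = XY(X + Y),  then multiplying by  -L₁L₂(L₁ + L₂)  is multiplying by XYZ.
  mulXYZ-via : ∀ a₁ b₁ a₂ b₂ → lin³ a₁ b₁ a₂ b₂ a₂ b₂ ⊕ lin³ a₁ b₁ a₁ b₁ a₂ b₂ ≡ cubic 0ℚ 1ℚ 1ℚ 0ℚ →
    ∀ G k → - (mulLin a₁ b₁ (mulLin a₂ b₂ (mulLin a₂ b₂ G)) k + mulLin a₁ b₁ (mulLin a₁ b₁ (mulLin a₂ b₂ G)) k)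
            ≡ mulXYZ G k
  mulXYZ-via a₁ b₁ a₂ b₂ compatible G k = begin
    - (mulLin a₁ b₁ (mulLin a₂ b₂ (mulLin a₂ b₂ G)) k + mulLin a₁ b₁ (mulLin a₁ b₁ (mulLin a₂ b₂ G)) k)
      ≡⟨ cong -_ (cong₂ _+_ (mulLin³ a₁ b₁ a₂ b₂ a₂ b₂ G k) (mulLin³ a₁ b₁ a₁ b₁ a₂ b₂ G k)) ⟩
    - (mulCubic (lin³ a₁ b₁ a₂ b₂ a₂ b₂) G k + mulCubic (lin³ a₁ b₁ a₁ b₁ a₂ b₂) G k)
      ≡⟨ cong -_ (sym (mulCubic-⊕ (lin³ a₁ b₁ a₂ b₂ a₂ b₂) (lin³ a₁ b₁ a₁ b₁ a₂ b₂) G k)) ⟩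
    - mulCubic (lin³ a₁ b₁ a₂ b₂ a₂ b₂ ⊕ lin³ a₁ b₁ a₁ b₁ a₂ b₂) G k
      ≡⟨ cong (λ C → - mulCubic C G k) compatible ⟩
    - mulCubic (cubic 0ℚ 1ℚ 1ℚ 0ℚ) G k
      ≡⟨ solve 4 (λ f s t u → :- (con 0ℚ :* f :+ con 1ℚ :* s :+ con 1ℚ :* t :+ con 0ℚ :* u) := :- (s :+ t))
               refl (G k) (shift G k) (shift (shift G) k) (shift (shift (shift G)) k) ⟩
    mulXYZ G k ∎
    where open ≡-Reasoning

  monoX : ℕ → Coeffs
  monoX zero    = one
  monoX (suc M) = shift (monoX M)

  monoX-supported : ∀ M → Supported (monoX M) M
  monoX-supported zero    (suc i) _         = refl
  monoX-supported (suc M) (suc i) (s≤s M<i) = monoX-supported M i M<i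

  monoX-top : ∀ M → monoX M M ≡ 1ℚ
  monoX-top zero    = refl
  monoX-top (suc M) = monoX-top M

  -- For c = coeff P this is
  -- literally  Defs.subst P L₁ L₂.
  module Substitution (a₁ b₁ a₂ b₂ : ℚ) where

    L₁ L₂ : Coeffs
    L₁ = linear a₁ b₁
    L₂ = linear a₂ b₂

    monomial : ℕ → ℕ → Coeffs
    monomial i j = conv (pow L₁ i) (pow L₂ j)

    substSeq : ℕ → Coeffs → Coeffs
    substSeq N c k = sumTo (suc N) (λ i → c i * monomial i (N ∸ i) k)

    substSeq-cong : ∀ N {c d : Coeffs} → (∀ i → i ≤ℕ N → c i ≡ d i) → substSeq N c ≐ substSeq N d
    substSeq-cong N h k = sumTo-cong< (suc N) (λ i i≤N → cong (_* monomial i (N ∸ i) k) (h i (ℕP.≤-pred i≤N)))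

    substSeq-add : ∀ N (c d : Coeffs) → substSeq N (λ i → c i + d i) ≐ (λ k → substSeq N c k + substSeq N d k)
    substSeq-add N c d k = trans
      (sumTo-cong (suc N) (λ i → ℚP.*-distribʳ-+ (monomial i (N ∸ i) k) (c i) (d i)))
      (sumTo-add (suc N) (λ i → c i * monomial i (N ∸ i) k) (λ i → d i * monomial i (N ∸ i) k))

    substSeq-scale : ∀ N r (c : Coeffs) → substSeq N (λ i → r * c i) ≐ (λ k → r * substSeq N c k)
    substSeq-scale N r c k = trans
      (sumTo-cong (suc N) (λ i → ℚP.*-assoc r (c i) (monomial i (N ∸ i) k)))
      (sumTo-scale (suc N) r (λ i → c i * monomial i (N ∸ i) k))

    substSeq-lin : ∀ N (c d : Coeffs) r → substSeq N (λ i → c i + r * d i) ≐ (λ k → substSeq N c k + r * substSeq N d k)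
    substSeq-lin N c d r k = trans (substSeq-add N c (λ i → r * d i) k) (cong (substSeq N c k +_) (substSeq-scale N r d k))

    substSeq₀ : ∀ c → substSeq 0 c ≐ (λ k → c 0 * one k)
    substSeq₀ c k = trans (ℚP.+-identityʳ _) (cong (c 0 *_) (conv-oneˡ (pow L₂ 0) k))

    sum-mulLin : ∀ n a b (c : ℕ → ℚ) (G : ℕ → Coeffs) →
      (λ k → sumTo n (λ i → c i * mulLin a b (G i) k)) ≐ mulLin a b (λ k → sumTo n (λ i → c i * G i k))
    sum-mulLin n a b c G k = begin
      sumTo n (λ i → c i * (b * G i k + a * shift (G i) k))
        ≡⟨ sumTo-cong n (λ i → solve 5 (λ c b x a y → c :* (b :* x :+ a :* y) := b :* (c :* x) :+ a :* (c :* y))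
                                        refl (c i) b (G i k) a (shift (G i) k)) ⟩
      sumTo n (λ i → b * (c i * G i k) + a * (c i * shift (G i) k))
        ≡⟨ sumTo-lin n b a (λ i → c i * G i k) (λ i → c i * shift (G i) k) ⟩
      b * sumTo n (λ i → c i * G i k) + a * sumTo n (λ i → c i * shift (G i) k)
        ≡⟨ cong (λ z → b * sumTo n (λ i → c i * G i k) + a * z) (shifted k) ⟩
      b * sumTo n (λ i → c i * G i k) + a * shift (λ k → sumTo n (λ i → c i * G i k)) k ∎
      where
      open ≡-Reasoning
      shifted : ∀ k → sumTo n (λ i → c i * shift (G i) k) ≡ shift (λ k → sumTo n (λ i → c i * G i k)) k
      shifted zero    = sumTo-zero n (λ i → ℚP.*-zeroʳ (c i))
      shifted (suc k) = refl

    -- P(L₁,L₂) = c₀ L₂^(N+1) + L₁ · P′(L₁,L₂)   where  P = c₀ Y^(N+1) + X P′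
    substSeq-peel : ∀ N c → substSeq (suc N) c ≐
      (λ k → c 0 * pow L₂ (suc N) k + mulLin a₁ b₁ (substSeq N (λ i → c (suc i))) k)
    substSeq-peel N c k = cong₂ _+_ (cong (c 0 *_) (conv-oneˡ (pow L₂ (suc N)) k)) (begin
      sumTo (suc N) (λ i → c (suc i) * monomial (suc i) (N ∸ i) k)
        ≡⟨ sumTo-cong (suc N) (λ i → cong (c (suc i) *_) (conv-mulLinˡ a₁ b₁ (pow L₁ i) (pow L₂ (N ∸ i)) k)) ⟩
      sumTo (suc N) (λ i → c (suc i) * mulLin a₁ b₁ (monomial i (N ∸ i)) k)
        ≡⟨ sum-mulLin (suc N) a₁ b₁ (λ i → c (suc i)) (λ i → monomial i (N ∸ i)) k ⟩
      mulLin a₁ b₁ (substSeq N (λ i → c (suc i))) k ∎)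
      where open ≡-Reasoning

    substSeq-shift : ∀ N c → substSeq (suc N) (shift c) ≐ mulLin a₁ b₁ (substSeq N c)
    substSeq-shift N c k = trans (substSeq-peel N (shift c) k)
      (trans (cong (_+ mulLin a₁ b₁ (substSeq N c) k) (ℚP.*-zeroˡ (pow L₂ (suc N) k)))
             (ℚP.+-identityˡ (mulLin a₁ b₁ (substSeq N c) k)))

    -- (Y·P)(L₁,L₂) = L₂ · P(L₁,L₂): reading P in degree N+1 multiplies it by Y
    substSeq-Y : ∀ N c → c (suc N) ≡ 0ℚ → substSeq (suc N) c ≐ mulLin a₂ b₂ (substSeq N c)
    substSeq-Y N c c₊≡0 k = begin
      substSeq (suc N) c k
        ≡⟨ sumTo-last (suc N) (λ i → c i * monomial i (suc N ∸ i) k) ⟩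
      sumTo (suc N) (λ i → c i * monomial i (suc N ∸ i) k) + c (suc N) * monomial (suc N) (suc N ∸ suc N) k
        ≡⟨ cong₂ _+_ (sumTo-cong< (suc N) (λ i i≤N →
                        cong (λ m → c i * monomial i m k) (ℕP.+-∸-assoc 1 (ℕP.≤-pred i≤N))))
                     (trans (cong (_* monomial (suc N) (N ∸ N) k) c₊≡0) (ℚP.*-zeroˡ (monomial (suc N) (N ∸ N) k))) ⟩
      sumTo (suc N) (λ i → c i * monomial i (suc (N ∸ i)) k) + 0ℚ
        ≡⟨ ℚP.+-identityʳ _ ⟩
      sumTo (suc N) (λ i → c i * monomial i (suc (N ∸ i)) k)
        ≡⟨ sumTo-cong (suc N) (λ i → cong (c i *_) (conv-mulLinʳ a₂ b₂ (pow L₁ i) (pow L₂ (N ∸ i)) k)) ⟩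
      sumTo (suc N) (λ i → c i * mulLin a₂ b₂ (monomial i (N ∸ i)) k)
        ≡⟨ sum-mulLin (suc N) a₂ b₂ c (λ i → monomial i (N ∸ i)) k ⟩
      mulLin a₂ b₂ (substSeq N c) k ∎
      where open ≡-Reasoning

    substSeq-mulXYZ : ∀ n c → c (suc n) ≡ 0ℚ → c (suc (suc n)) ≡ 0ℚ →
      substSeq (3 ℕ.+ n) (mulXYZ c) ≐
        (λ k → - (mulLin a₁ b₁ (mulLin a₂ b₂ (mulLin a₂ b₂ (substSeq n c))) k
                  + mulLin a₁ b₁ (mulLin a₁ b₁ (mulLin a₂ b₂ (substSeq n c))) k))
    substSeq-mulXYZ n c c₁≡0 c₂≡0 k = begin
      substSeq (3 ℕ.+ n) (mulXYZ c) k
        ≡⟨ substSeq-cong (3 ℕ.+ n) (λ i _ → negate (shift c i + shift (shift c) i)) k ⟩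
      substSeq (3 ℕ.+ n) (λ i → (- 1ℚ) * (shift c i + shift (shift c) i)) k
        ≡⟨ substSeq-scale (3 ℕ.+ n) (- 1ℚ) (λ i → shift c i + shift (shift c) i) k ⟩
      (- 1ℚ) * substSeq (3 ℕ.+ n) (λ i → shift c i + shift (shift c) i) k
        ≡⟨ cong ((- 1ℚ) *_) (substSeq-add (3 ℕ.+ n) (shift c) (shift (shift c)) k) ⟩
      (- 1ℚ) * (substSeq (3 ℕ.+ n) (shift c) k + substSeq (3 ℕ.+ n) (shift (shift c)) k)
        ≡⟨ cong₂ (λ x y → (- 1ℚ) * (x + y)) XY²-term X²Y-term ⟩
      (- 1ℚ) * (mulLin a₁ b₁ (mulLin a₂ b₂ (mulLin a₂ b₂ S)) k + mulLin a₁ b₁ (mulLin a₁ b₁ (mulLin a₂ b₂ S)) k)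
        ≡⟨ sym (negate _) ⟩
      - (mulLin a₁ b₁ (mulLin a₂ b₂ (mulLin a₂ b₂ S)) k + mulLin a₁ b₁ (mulLin a₁ b₁ (mulLin a₂ b₂ S)) k) ∎
      where
      open ≡-Reasoning
      S = substSeq n c
      negate : ∀ x → - x ≡ (- 1ℚ) * x
      negate = solve 1 (λ x → :- x := (:- con 1ℚ) :* x) refl
      Y-c : substSeq (suc n) c ≐ mulLin a₂ b₂ S
      Y-c = substSeq-Y n c c₁≡0
      Y²-c : substSeq (2 ℕ.+ n) c ≐ mulLin a₂ b₂ (mulLin a₂ b₂ S)
      Y²-c k = trans (substSeq-Y (suc n) c c₂≡0 k) (mulLin-cong a₂ b₂ Y-c k)
      XY-c : substSeq (2 ℕ.+ n) (shift c) ≐ mulLin a₁ b₁ (mulLin a₂ b₂ S)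
      XY-c k = trans (substSeq-shift (suc n) c k) (mulLin-cong a₁ b₁ Y-c k)
      XY²-term : substSeq (3 ℕ.+ n) (shift c) k ≡ mulLin a₁ b₁ (mulLin a₂ b₂ (mulLin a₂ b₂ S)) k
      XY²-term = trans (substSeq-shift (2 ℕ.+ n) c k) (mulLin-cong a₁ b₁ Y²-c k)
      X²Y-term : substSeq (3 ℕ.+ n) (shift (shift c)) k ≡ mulLin a₁ b₁ (mulLin a₁ b₁ (mulLin a₂ b₂ S)) k
      X²Y-term = trans (substSeq-shift (2 ℕ.+ n) (shift c) k) (mulLin-cong a₁ b₁ XY-c k)

    substSeq-supported : ∀ N c → Supported (substSeq N c) N
    substSeq-supported zero    c (suc k) _   = trans (substSeq₀ c (suc k)) (ℚP.*-zeroʳ (c 0))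
    substSeq-supported (suc N) c k       N<k = trans (substSeq-peel N c k)
      (trans (cong₂ _+_ (trans (cong (c 0 *_) (pow-supported a₂ b₂ (suc N) k N<k)) (ℚP.*-zeroʳ (c 0)))
                        (mulLin-supported a₁ b₁ N (substSeq-supported N (λ i → c (suc i))) k N<k))
             (ℚP.+-identityʳ 0ℚ))

    substSeq₀-const : ∀ c → substSeq 0 c 0 ≡ c 0
    substSeq₀-const c = trans (substSeq₀ c 0) (ℚP.*-identityʳ (c 0))

    substSeq-top : ∀ N c → substSeq (suc N) c (suc N) ≡ c 0 * power a₂ (suc N) + a₁ * substSeq N (λ i → c (suc i)) N
    substSeq-top N c = trans (substSeq-peel N c (suc N))
      (cong₂ _+_ (cong (c 0 *_) (pow-top a₂ b₂ (suc N))) (mulLin-top a₁ b₁ N (substSeq-supported N (λ i → c (suc i)))))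

    substSeq-bottom : ∀ N c → substSeq (suc N) c 0 ≡ c 0 * power b₂ (suc N) + b₁ * substSeq N (λ i → c (suc i)) 0
    substSeq-bottom N c = trans (substSeq-peel N c 0)
      (cong₂ _+_ (cong (c 0 *_) (pow-bottom a₂ b₂ (suc N))) (mulLin-bottom a₁ b₁ (substSeq N (λ i → c (suc i)))))

    substSeq-X^ : ∀ M → substSeq M (monoX M) ≐ pow L₁ M
    substSeq-X^ zero    k = trans (substSeq₀ one k) (ℚP.*-identityˡ (one k))
    substSeq-X^ (suc M) k = trans (substSeq-shift M (monoX M) k)
      (trans (mulLin-cong a₁ b₁ (substSeq-X^ M) k) (sym (conv-linear a₁ b₁ (pow L₁ M) k)))

    substSeq-Y^ : ∀ M → substSeq M one ≐ pow L₂ M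
    substSeq-Y^ zero    k = trans (substSeq₀ one k) (ℚP.*-identityˡ (one k))
    substSeq-Y^ (suc M) k = trans (substSeq-Y M one refl k)
      (trans (mulLin-cong a₂ b₂ (substSeq-Y^ M) k) (sym (conv-linear a₂ b₂ (pow L₂ M) k)))

  coeff-in : ∀ {N} (P : Form N) i (i<N+1 : i <ℕ suc N) → coeff P i ≡ P (fromℕ< i<N+1)
  coeff-in {N} P i i<N+1 with i <? suc N
  ... | yes _     = refl
  ... | no  i≮N+1 = ⊥-elim (i≮N+1 i<N+1)

  coeff-supported : ∀ {N} (P : Form N) → Supported (coeff P) N
  coeff-supported {N} P i N<i with i <? suc N
  ... | yes i<N+1 = ⊥-elim (ℕP.<⇒≱ N<i (ℕP.≤-pred i<N+1))
  ... | no  _     = refl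

  coeff-toℕ : ∀ {N} (P : Form N) j → coeff P (toℕ j) ≡ P j
  coeff-toℕ P j = trans (coeff-in P (toℕ j) (FinP.toℕ<n j)) (cong P (FinP.fromℕ<-toℕ j (FinP.toℕ<n j)))

  coeff-top : ∀ {N} (P : Form N) → coeff P N ≡ P (fromℕ N)
  coeff-top {N} P = trans (cong (coeff P) (sym (FinP.toℕ-fromℕ N))) (coeff-toℕ P (fromℕ N))

  coeff-cong : ∀ {N} {P Q : Form N} → (∀ j → P j ≡ Q j) → coeff P ≐ coeff Q
  coeff-cong {N} h i with i <? suc N
  ... | yes _ = h _
  ... | no  _ = refl

  coeff-lin : ∀ {N} (P Q : Form N) r → coeff (λ j → P j + r * Q j) ≐ (λ i → coeff P i + r * coeff Q i)
  coeff-lin {N} P Q r i with i <? suc N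
  ... | yes _ = refl
  ... | no  _ = solve 1 (λ r → con 0ℚ := con 0ℚ :+ r :* con 0ℚ) refl r

  coeff-vanish : ∀ {N} (P : Form N) → (∀ i → i ≤ℕ N → coeff P i ≡ 0ℚ) → ∀ j → P j ≡ 0ℚ
  coeff-vanish P h j = trans (sym (coeff-toℕ P j)) (h (toℕ j) (ℕP.≤-pred (FinP.toℕ<n j)))

  toForm : ∀ N → Coeffs → Form N
  toForm N c j = c (toℕ j)

  coeff-toForm : ∀ N c → Supported c N → coeff (toForm N c) ≐ c
  coeff-toForm N c c≤N i with i <? suc N
  ... | yes i<N+1 = cong c (FinP.toℕ-fromℕ< i<N+1)
  ... | no  i≮N+1 = sym (c≤N i (ℕP.≮⇒≥ i≮N+1))

  mulXYZᶠ : ∀ {n} → Form n → Form (3 ℕ.+ n)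
  mulXYZᶠ {n} Q = toForm (3 ℕ.+ n) (mulXYZ (coeff Q))

  coeff-mulXYZᶠ : ∀ {n} (Q : Form n) → coeff (mulXYZᶠ Q) ≐ mulXYZ (coeff Q)
  coeff-mulXYZᶠ {n} Q = coeff-toForm (3 ℕ.+ n) (mulXYZ (coeff Q)) (mulXYZ-supported n (coeff Q) (coeff-supported Q))

  mulXYZᶠ-top : ∀ {n} (Q : Form n) → mulXYZᶠ Q (fromℕ (3 ℕ.+ n)) ≡ 0ℚ
  mulXYZᶠ-top {n} Q = trans (cong (mulXYZ (coeff Q)) (FinP.toℕ-fromℕ (3 ℕ.+ n))) (mulXYZ-top n (coeff Q) (coeff-supported Q))

  -- The four substitutions (X,Y) ↦ (L₁,L₂) occurring in the relations defining W_N,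
  -- Lᵢ = αᵢ X + βᵢ Y, and Z = -X-Y.
  data Sub : Set where
    σXY σYX σYZ σZX : Sub

  α₁ β₁ α₂ β₂ : Sub → ℚ
  α₁ σXY = 1ℚ
  α₁ σYX = 0ℚ
  α₁ σYZ = 0ℚ
  α₁ σZX = - 1ℚ
  β₁ σXY = 0ℚ
  β₁ σYX = 1ℚ
  β₁ σYZ = 1ℚ
  β₁ σZX = - 1ℚ
  α₂ σXY = 0ℚ
  α₂ σYX = 1ℚ
  α₂ σYZ = - 1ℚ
  α₂ σZX = 1ℚ
  β₂ σXY = 1ℚ
  β₂ σYX = 0ℚ
  β₂ σYZ = - 1ℚ
  β₂ σZX = 0ℚ

  module Subst (s : Sub) = Substitution (α₁ s) (β₁ s) (α₂ s) (β₂ s)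

  image : ∀ {N} → Form N → Sub → Coeffs
  image {N} P s = Subst.substSeq s N (coeff P)

  -- Each substitution permutes X, Y, Z up to the sign of Z, so  L₁L₂(L₁+L₂) = XY(X+Y).
  compatible : ∀ s → lin³ (α₁ s) (β₁ s) (α₂ s) (β₂ s) (α₂ s) (β₂ s)
                     ⊕ lin³ (α₁ s) (β₁ s) (α₁ s) (β₁ s) (α₂ s) (β₂ s)
                     ≡ cubic 0ℚ 1ℚ 1ℚ 0ℚ
  compatible σXY = refl
  compatible σYX = refl
  compatible σYZ = refl
  compatible σZX = refl

  image-cong : ∀ {N} {P Q : Form N} → (∀ j → P j ≡ Q j) → ∀ s → image P s ≐ image Q s
  image-cong {N} h s = Subst.substSeq-cong s N (λ i _ → coeff-cong h i)

  image-lin : ∀ {N} (P Q : Form N) r s → image (λ j → P j + r * Q j) s ≐ (λ k → image P s k + r * image Q s k)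
  image-lin {N} P Q r s k = trans (Subst.substSeq-cong s N (λ i _ → coeff-lin P Q r i) k)
                                  (Subst.substSeq-lin s N (coeff P) (coeff Q) r k)

  image-mulXYZ : ∀ {n} (Q : Form n) s → image (mulXYZᶠ Q) s ≐ mulXYZ (image Q s)
  image-mulXYZ {n} Q s k = begin
    substSeq (3 ℕ.+ n) (coeff (mulXYZᶠ Q)) k
      ≡⟨ substSeq-cong (3 ℕ.+ n) (λ i _ → coeff-mulXYZᶠ Q i) k ⟩
    substSeq (3 ℕ.+ n) (mulXYZ (coeff Q)) k
      ≡⟨ substSeq-mulXYZ n (coeff Q)
           (coeff-supported Q (suc n) (ℕP.n<1+n n)) (coeff-supported Q (2 ℕ.+ n) (ℕP.m<n⇒m<1+n (ℕP.n<1+n n))) k ⟩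
    - (mulLin (α₁ s) (β₁ s) (mulLin (α₂ s) (β₂ s) (mulLin (α₂ s) (β₂ s) (image Q s))) k
       + mulLin (α₁ s) (β₁ s) (mulLin (α₁ s) (β₁ s) (mulLin (α₂ s) (β₂ s) (image Q s))) k)
      ≡⟨ mulXYZ-via (α₁ s) (β₁ s) (α₂ s) (β₂ s) (compatible s) (image Q s) k ⟩
    mulXYZ (image Q s) k ∎
    where
    open ≡-Reasoning
    open Subst s

  -- The two relations defining W_N, as combinations of the substitution images:
  --   InW N P  is by definition  antisymRel (image P) ≐ 0  and  cyclicRel (image P) ≐ 0.
  antisymRel cyclicRel : (Sub → Coeffs) → Coeffs
  antisymRel g k = g σXY k + g σYX k
  cyclicRel  g k = g σXY k + g σYZ k + g σZX k

  -- What the argument uses of a relation: it is a linear combination of the images.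
  record IsRelation (R : (Sub → Coeffs) → Coeffs) : Set where
    field
      rel-cong   : ∀ {g h} → (∀ s → g s ≐ h s) → R g ≐ R h
      rel-lin    : ∀ r g h k → R (λ s k → g s k + r * h s k) k ≡ R g k + r * R h k
      rel-mulXYZ : ∀ g → R (λ s → mulXYZ (g s)) ≐ mulXYZ (R g)

  antisym-isRelation : IsRelation antisymRel
  antisym-isRelation = record
    { rel-cong   = λ h k → cong₂ _+_ (h σXY k) (h σYX k)
    ; rel-lin    = λ r g h k → solve 5 (λ a b c d r → (a :+ r :* b) :+ (c :+ r :* d) := (a :+ c) :+ r :* (b :+ d))
                                        refl (g σXY k) (h σXY k) (g σYX k) (h σYX k) r
    ; rel-mulXYZ = λ g k → sym (mulXYZ-add (g σXY) (g σYX) k)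
    }

  cyclic-isRelation : IsRelation cyclicRel
  cyclic-isRelation = record
    { rel-cong   = λ h k → cong₂ _+_ (cong₂ _+_ (h σXY k) (h σYZ k)) (h σZX k)
    ; rel-lin    = λ r g h k → solve 7 (λ a b c d e f r →
                       (a :+ r :* b) :+ (c :+ r :* d) :+ (e :+ r :* f) := (a :+ c :+ e) :+ r :* (b :+ d :+ f))
                     refl (g σXY k) (h σXY k) (g σYZ k) (h σYZ k) (g σZX k) (h σZX k) r
    ; rel-mulXYZ = λ g k → sym (trans (mulXYZ-add (λ i → g σXY i + g σYZ i) (g σZX) k)
                                      (cong (_+ mulXYZ (g σZX) k) (mulXYZ-add (g σXY) (g σYZ) k)))
    }

  module Holding {R : (Sub → Coeffs) → Coeffs} (isRel : IsRelation R) where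
    open IsRelation isRel

    Holds : ∀ {N} → Form N → Set
    Holds P = R (image P) ≐ (λ _ → 0ℚ)

    holds-cong : ∀ {N} {P Q : Form N} → (∀ j → P j ≡ Q j) → Holds P → Holds Q
    holds-cong P≡Q holdsP k = trans (sym (rel-cong (image-cong P≡Q) k)) (holdsP k)

    holds-lin : ∀ {N} {P Q : Form N} r → Holds P → Holds Q → Holds (λ j → P j + r * Q j)
    holds-lin {P = P} {Q} r holdsP holdsQ k = begin
      R (image (λ j → P j + r * Q j)) k
        ≡⟨ rel-cong (image-lin P Q r) k ⟩
      R (λ s k → image P s k + r * image Q s k) k
        ≡⟨ rel-lin r (image P) (image Q) k ⟩
      R (image P) k + r * R (image Q) k
        ≡⟨ cong₂ (λ x y → x + r * y) (holdsP k) (holdsQ k) ⟩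
      0ℚ + r * 0ℚ
        ≡⟨ solve 1 (λ r → con 0ℚ :+ r :* con 0ℚ := con 0ℚ) refl r ⟩
      0ℚ ∎
      where open ≡-Reasoning

    rel-image-mulXYZ : ∀ {n} (Q : Form n) → R (image (mulXYZᶠ Q)) ≐ mulXYZ (R (image Q))
    rel-image-mulXYZ Q k = trans (rel-cong (image-mulXYZ Q) k) (rel-mulXYZ (image Q) k)

    holds-mulXYZ : ∀ {n} {Q : Form n} → Holds Q → Holds (mulXYZᶠ Q)
    holds-mulXYZ {Q = Q} holdsQ k = trans (rel-image-mulXYZ Q k) (mulXYZ-zero holdsQ k)

    holds-mulXYZ⁻ : ∀ {n} {Q : Form n} → Holds (mulXYZᶠ Q) → Holds Q
    holds-mulXYZ⁻ {Q = Q} holdsXYZQ = mulXYZ-injective (λ k → trans (sym (rel-image-mulXYZ Q k)) (holdsXYZQ k))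

  private
    module A = Holding antisym-isRelation
    module C = Holding cyclic-isRelation

  InW-cong : ∀ {N} {P Q : Form N} → (∀ j → P j ≡ Q j) → InW N P → InW N Q
  InW-cong {P = P} {Q} P≡Q (antisymP , cyclicP) =
    A.holds-cong {P = P} {Q} P≡Q antisymP , C.holds-cong {P = P} {Q} P≡Q cyclicP

  LinClosed : ∀ {N} → (Form N → Set) → Set
  LinClosed {N} W = ∀ (P Q : Form N) r → W P → W Q → W (λ j → P j + r * Q j)

  InW-lin : ∀ {N} → LinClosed (InW N)
  InW-lin P Q r (antisymP , cyclicP) (antisymQ , cyclicQ) =
    A.holds-lin {P = P} {Q} r antisymP antisymQ , C.holds-lin {P = P} {Q} r cyclicP cyclicQ

  InW-mulXYZ : ∀ {n} {Q : Form n} → InW n Q → InW (3 ℕ.+ n) (mulXYZᶠ Q)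
  InW-mulXYZ {Q = Q} (antisymQ , cyclicQ) = A.holds-mulXYZ {Q = Q} antisymQ , C.holds-mulXYZ {Q = Q} cyclicQ

  InW-mulXYZ⁻ : ∀ {n} {Q : Form n} → InW (3 ℕ.+ n) (mulXYZᶠ Q) → InW n Q
  InW-mulXYZ⁻ {Q = Q} (antisym , cyclic) = A.holds-mulXYZ⁻ {Q = Q} antisym , C.holds-mulXYZ⁻ {Q = Q} cyclic

  sign : ℕ → ℚ
  sign = power (- 1ℚ)

  sign-sq : ∀ j → sign j * sign j ≡ 1ℚ
  sign-sq zero    = refl
  sign-sq (suc j) = trans (solve 1 (λ g → ((:- con 1ℚ) :* g) :* ((:- con 1ℚ) :* g) := g :* g) refl (sign j))
                          (sign-sq j)

  -- the alternating sum  Σ_{i ≤ M} (-1)^i c i,  i.e. the form evaluated at (X,Y) = (1,-1) up to sign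
  altSum : ℕ → Coeffs → ℚ
  altSum M c = sumTo (suc M) (λ i → sign i * c i)

  altSum-suc : ∀ M c → altSum (suc M) c ≡ c 0 + - altSum M (λ i → c (suc i))
  altSum-suc M c = begin
    1ℚ * c 0 + sumTo (suc M) (λ i → (- 1ℚ * sign i) * c (suc i))
      ≡⟨ cong₂ _+_ (ℚP.*-identityˡ (c 0)) (sumTo-cong (suc M) (λ i → ℚP.*-assoc (- 1ℚ) (sign i) (c (suc i)))) ⟩
    c 0 + sumTo (suc M) (λ i → - 1ℚ * (sign i * c (suc i)))
      ≡⟨ cong (c 0 +_) (sumTo-scale (suc M) (- 1ℚ) (λ i → sign i * c (suc i))) ⟩
    c 0 + - 1ℚ * altSum M (λ i → c (suc i))
      ≡⟨ cong (c 0 +_) (solve 1 (λ x → (:- con 1ℚ) :* x := :- x) refl (altSum M (λ i → c (suc i)))) ⟩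
    c 0 + - altSum M (λ i → c (suc i)) ∎
    where open ≡-Reasoning

  XY-bottom : ∀ N c → Subst.substSeq σXY N c 0 ≡ c 0
  XY-bottom zero    c = Subst.substSeq₀-const σXY c
  XY-bottom (suc N) c = trans (Subst.substSeq-bottom σXY N c)
    (trans (cong (λ x → c 0 * x + 0ℚ * Subst.substSeq σXY N (λ i → c (suc i)) 0) (power-one (suc N)))
           (solve 2 (λ a y → a :* con 1ℚ :+ con 0ℚ :* y := a) refl (c 0) (Subst.substSeq σXY N (λ i → c (suc i)) 0)))

  YX-bottom : ∀ N c → Subst.substSeq σYX N c 0 ≡ c N
  YX-bottom zero    c = Subst.substSeq₀-const σYX c
  YX-bottom (suc N) c = trans (Subst.substSeq-bottom σYX N c)
    (trans (cong (λ y → c 0 * power 0ℚ (suc N) + 1ℚ * y) (YX-bottom N (λ i → c (suc i))))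
           (solve 3 (λ a p y → a :* (con 0ℚ :* p) :+ con 1ℚ :* y := y) refl (c 0) (power 0ℚ N) (c (suc N))))

  XY-top : ∀ N c → Subst.substSeq σXY N c N ≡ c N
  XY-top zero    c = Subst.substSeq₀-const σXY c
  XY-top (suc N) c = trans (Subst.substSeq-top σXY N c)
    (trans (cong (λ y → c 0 * power 0ℚ (suc N) + 1ℚ * y) (XY-top N (λ i → c (suc i))))
           (solve 3 (λ a p y → a :* (con 0ℚ :* p) :+ con 1ℚ :* y := y) refl (c 0) (power 0ℚ N) (c (suc N))))

  YZ-top : ∀ N c → Subst.substSeq σYZ N c N ≡ sign N * c 0
  YZ-top zero    c = trans (Subst.substSeq₀-const σYZ c) (sym (ℚP.*-identityˡ (c 0)))
  YZ-top (suc N) c = trans (Subst.substSeq-top σYZ N c)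
    (solve 3 (λ a g y → a :* g :+ con 0ℚ :* y := g :* a) refl (c 0) (sign (suc N)) (Subst.substSeq σYZ N (λ i → c (suc i)) N))

  ZX-top : ∀ N c → Subst.substSeq σZX N c N ≡ altSum N c
  ZX-top zero    c = trans (Subst.substSeq₀-const σZX c) (solve 1 (λ a → a := con 1ℚ :* a :+ con 0ℚ) refl (c 0))
  ZX-top (suc N) c = begin
    Subst.substSeq σZX (suc N) c (suc N)
      ≡⟨ Subst.substSeq-top σZX N c ⟩
    c 0 * power 1ℚ (suc N) + - 1ℚ * Subst.substSeq σZX N (λ i → c (suc i)) N
      ≡⟨ cong₂ (λ x y → c 0 * x + - 1ℚ * y) (power-one (suc N)) (ZX-top N (λ i → c (suc i))) ⟩
    c 0 * 1ℚ + - 1ℚ * altSum N (λ i → c (suc i))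
      ≡⟨ solve 2 (λ a y → a :* con 1ℚ :+ (:- con 1ℚ) :* y := a :+ :- y) refl (c 0) (altSum N (λ i → c (suc i))) ⟩
    c 0 + - altSum N (λ i → c (suc i))
      ≡⟨ sym (altSum-suc N c) ⟩
    altSum (suc N) c ∎
    where open ≡-Reasoning

  antisym-bottom : ∀ {N} (P : Form N) → InW N P → coeff P 0 + coeff P N ≡ 0ℚ
  antisym-bottom {N} P (antisymP , _) =
    trans (sym (cong₂ _+_ (XY-bottom N (coeff P)) (YX-bottom N (coeff P)))) (antisymP 0)

  cyclic-top : ∀ {N} (P : Form N) → InW N P → coeff P N + sign N * coeff P 0 + altSum N (coeff P) ≡ 0ℚ
  cyclic-top {N} P (_ , cyclicP) =
    trans (sym (cong₂ _+_ (cong₂ _+_ (XY-top N (coeff P)) (YZ-top N (coeff P))) (ZX-top N (coeff P)))) (cyclicP N)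

  -- If P ∈ W_N has no X^N term, then it has no Y^N term and vanishes at (X,Y) = (1,-1):
  -- P is divisible by X, Y and X + Y.
  vanishing : ∀ {N} (P : Form N) → InW N P → coeff P N ≡ 0ℚ → coeff P 0 ≡ 0ℚ × altSum N (coeff P) ≡ 0ℚ
  vanishing {N} P w pN≡0 = p₀≡0 , alt≡0
    where
    p₀≡0 : coeff P 0 ≡ 0ℚ
    p₀≡0 = trans (sym (ℚP.+-identityʳ _)) (trans (cong (coeff P 0 +_) (sym pN≡0)) (antisym-bottom P w))
    alt≡0 : altSum N (coeff P) ≡ 0ℚ
    alt≡0 = trans (solve 2 (λ g a → a := con 0ℚ :+ g :* con 0ℚ :+ a) refl (sign N) (altSum N (coeff P)))
                  (trans (cong₂ (λ x y → x + sign N * y + altSum N (coeff P)) (sym pN≡0) (sym p₀≡0)) (cyclic-top P w))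

  -- Dividing a form S by -Y(X+Y): the candidate quotient coefficients are the signed partial
  -- alternating sums of S; they satisfy  q₀ = -s₀  and  q_(j+1) + q_j = -s_(j+1).
  quotient : Coeffs → Coeffs
  quotient s j = - (sign j * altSum j s)

  quotient-base : ∀ s → quotient s 0 ≡ - s 0
  quotient-base s = solve 1 (λ a → :- (con 1ℚ :* (con 1ℚ :* a :+ con 0ℚ)) := :- a) refl (s 0)

  quotient-step : ∀ s j → quotient s (suc j) + quotient s j ≡ - s (suc j)
  quotient-step s j = begin
    - (- 1ℚ * g * altSum (suc j) s) + - (g * A)
      ≡⟨ cong (λ z → - (- 1ℚ * g * z) + - (g * A)) (sumTo-last (suc j) (λ i → sign i * s i)) ⟩
    - (- 1ℚ * g * (A + - 1ℚ * g * s (suc j))) + - (g * A)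
      ≡⟨ solve 3 (λ g a x → :- ((:- con 1ℚ) :* g :* (a :+ (:- con 1ℚ) :* g :* x)) :+ :- (g :* a) := :- ((g :* g) :* x))
               refl g A (s (suc j)) ⟩
    - ((g * g) * s (suc j))
      ≡⟨ cong (λ z → - (z * s (suc j))) (sign-sq j) ⟩
    - (1ℚ * s (suc j))
      ≡⟨ cong -_ (ℚP.*-identityˡ (s (suc j))) ⟩
    - s (suc j) ∎
    where
    open ≡-Reasoning
    g A : ℚ
    g = sign j
    A = altSum j s

  -- For P = X·S of degree m+2 with no X^(m+2) term and P(1,-1) = 0, the quotient of S
  -- by -Y(X+Y) has no coefficient in degree m: the division is exact.
  quotient-last : ∀ m (p : Coeffs) → p 0 ≡ 0ℚ → p (2 ℕ.+ m) ≡ 0ℚ → altSum (2 ℕ.+ m) p ≡ 0ℚ →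
    quotient (λ i → p (suc i)) m ≡ 0ℚ
  quotient-last m p p₀≡0 top≡0 altP≡0 = trans (cong (λ z → - (sign m * z)) altS≡0) (cong -_ (ℚP.*-zeroʳ (sign m)))
    where
    open ≡-Reasoning
    s : Coeffs
    s i = p (suc i)
    altS₊≡0 : altSum (suc m) s ≡ 0ℚ
    altS₊≡0 = trans (solve 2 (λ a x → a := :- (x :+ :- a) :+ x) refl (altSum (suc m) s) (p 0))
      (cong₂ (λ y x → - y + x) (trans (sym (altSum-suc (suc m) p)) altP≡0) p₀≡0)
    lastTerm≡0 : sign (suc m) * s (suc m) ≡ 0ℚ
    lastTerm≡0 = trans (cong (sign (suc m) *_) top≡0) (ℚP.*-zeroʳ (sign (suc m)))
    altS≡0 : altSum m s ≡ 0ℚ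
    altS≡0 = begin
      altSum m s                              ≡⟨ sym (ℚP.+-identityʳ _) ⟩
      altSum m s + 0ℚ                         ≡⟨ cong (altSum m s +_) (sym lastTerm≡0) ⟩
      altSum m s + sign (suc m) * s (suc m)   ≡⟨ sym (sumTo-last (suc m) (λ i → sign i * s i)) ⟩
      altSum (suc m) s                        ≡⟨ altS₊≡0 ⟩
      0ℚ                                      ∎

  -- P has no Y^N term, so P = X·S, and Q is the quotient of S by -Y(X+Y); it has degree n
  -- because P(1,-1) = 0, and P = XYZ·Q is checked coefficient by coefficient.
  division : ∀ n (P : Form (3 ℕ.+ n)) → InW (3 ℕ.+ n) P → P (fromℕ (3 ℕ.+ n)) ≡ 0ℚ →
    Σ (Form n) (λ Q → ∀ j → P j ≡ mulXYZᶠ Q j)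
  division n P w top≡0 = Q , λ j → trans (sym (coeff-toℕ P j)) (P≐XYZQ (toℕ j) (ℕP.≤-pred (FinP.toℕ<n j)))
    where
    p s : Coeffs
    p = coeff P
    s i = p (suc i)
    pN≡0 : p (3 ℕ.+ n) ≡ 0ℚ
    pN≡0 = trans (coeff-top P) top≡0
    p₀≡0 : p 0 ≡ 0ℚ
    p₀≡0 = proj₁ (vanishing P w pN≡0)

    q : ℕ → ℚ
    q = quotient s

    q-last : q (suc n) ≡ 0ℚ
    q-last = quotient-last (suc n) p p₀≡0 pN≡0 (proj₂ (vanishing P w pN≡0))

    Q : Form n
    Q j = q (toℕ j)

    coeff-Q : ∀ j → j ≤ℕ suc n → coeff Q j ≡ q j
    coeff-Q j j≤n+1 with ℕP.m≤n⇒m<n∨m≡n j≤n+1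
    ... | inj₁ j≤n = trans (coeff-in Q j j≤n) (cong q (FinP.toℕ-fromℕ< j≤n))
    ... | inj₂ refl = trans (coeff-supported Q (suc n) (ℕP.n<1+n n)) (sym q-last)

    P≐XYZQ : ∀ i → i ≤ℕ 3 ℕ.+ n → p i ≡ mulXYZ (coeff Q) i
    P≐XYZQ zero _ = p₀≡0
    P≐XYZQ (suc zero) _ = begin
      s 0                    ≡⟨ solve 1 (λ a → a := :- (:- a :+ con 0ℚ)) refl (s 0) ⟩
      - (- s 0 + 0ℚ)         ≡⟨ cong (λ z → - (z + 0ℚ)) (sym (trans (coeff-Q 0 z≤n) (quotient-base s))) ⟩
      - (coeff Q 0 + 0ℚ)     ∎
      where open ≡-Reasoning
    P≐XYZQ (suc (suc j)) (s≤s (s≤s j≤n+1)) with ℕP.m≤n⇒m<n∨m≡n j≤n+1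
    ... | inj₁ (s≤s j≤n) = begin
      s (suc j)                           ≡⟨ solve 1 (λ a → a := :- (:- a)) refl (s (suc j)) ⟩
      - (- s (suc j))                     ≡⟨ cong -_ (sym (quotient-step s j)) ⟩
      - (q (suc j) + q j)                 ≡⟨ cong₂ (λ x y → - (x + y)) (sym (coeff-Q (suc j) (s≤s j≤n)))
                                                                     (sym (coeff-Q j (ℕP.m≤n⇒m≤1+n j≤n))) ⟩
      - (coeff Q (suc j) + coeff Q j)     ∎
      where open ≡-Reasoning
    ... | inj₂ refl = trans pN≡0 (sym (mulXYZ-top n (coeff Q) (coeff-supported Q)))

  lead : ∀ {N} → Form N → ℚ
  lead {N} P = P (fromℕ N)

  Section : ∀ {N} → (Form N → Set) → Form N → Set
  Section W P = W P × lead P ≡ 0ℚ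

  HasDim-zero : ∀ {N} {W : Form N → Set} → (∀ P → W P → ∀ j → P j ≡ 0ℚ) → HasDim W 0
  HasDim-zero onlyZero = (λ ()) , (λ ()) , (λ a _ ()) , λ P wP → (λ ()) , onlyZero P wP

  -- If u ∈ W has leading coefficient 1 and K is a basis of the section of W, then
  -- u followed by K is a basis of W: every P ∈ W is  lead P · u  plus an element of the section.
  HasDim-extend : ∀ {N d} (W : Form N → Set) (u : Form N) → LinClosed W → W u → lead u ≡ 1ℚ →
    HasDim (Section W) d → HasDim W (suc d)
  HasDim-extend {N} {d} W u closed wu lead-u≡1 (K , memK , indepK , spanK) = (u ∷ K) , mem , indep , span
    where
    mem : ∀ i → W ((u ∷ K) i)
    mem zero    = wu
    mem (suc i) = proj₁ (memK i)

    indep : LinIndep (u ∷ K)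
    indep a comb≡0 = λ { zero → a₀≡0 ; (suc i) → indepK (λ i → a (suc i)) rest≡0 i }
      where
      rest : Form N
      rest = linComb (λ i → a (suc i)) K
      lead-rest : lead rest ≡ 0ℚ
      lead-rest = sumFin-zero (λ i → a (suc i) * K i (fromℕ N))
                              (λ i → trans (cong (a (suc i) *_) (proj₂ (memK i))) (ℚP.*-zeroʳ (a (suc i))))
      -- comparing leading coefficients gives a₀ = 0
      a₀≡0 : a zero ≡ 0ℚ
      a₀≡0 = trans (solve 2 (λ a r → a := a :* con 1ℚ :+ r :+ :- r) refl (a zero) (lead rest))
               (trans (cong₂ (λ x y → a zero * x + lead rest + - y) (sym lead-u≡1) lead-rest)
                      (cong (_+ - 0ℚ) (comb≡0 (fromℕ N))))
      rest≡0 : ∀ j → rest j ≡ 0ℚ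
      rest≡0 j = trans (solve 2 (λ x r → r := con 0ℚ :* x :+ r) refl (u j) (rest j))
                       (trans (cong (λ z → z * u j + rest j) (sym a₀≡0)) (comb≡0 j))

    span : Spans W (u ∷ K)
    span P wP = (c ∷ proj₁ inSection) , λ j →
      trans (solve 3 (λ p c u → p := c :* u :+ (p :+ (:- c) :* u)) refl (P j) c (u j))
            (cong (c * u j +_) (proj₂ inSection j))
      where
      c : ℚ
      c = lead P
      inSection : Σ (Fin d → ℚ) (λ a → ∀ j → P j + (- c) * u j ≡ linComb a K j)
      inSection = spanK (λ j → P j + (- c) * u j)
        ( closed P u (- c) wP wu
        , trans (cong (λ z → c + (- c) * z) lead-u≡1) (solve 1 (λ c → c :+ (:- c) :* con 1ℚ := con 0ℚ) refl c))

  mulXYZ-sumFin : ∀ {d} (a : Fin d → ℚ) (g : Fin d → Coeffs) k →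
    mulXYZ (λ i → sumFin (λ t → a t * g t i)) k ≡ sumFin (λ t → a t * mulXYZ (g t) k)
  mulXYZ-sumFin {zero}  a g k = mulXYZ-zero (λ _ → refl) k
  mulXYZ-sumFin {suc d} a g k = trans (mulXYZ-lin (a zero) (g zero) (λ i → sumFin (λ t → a (suc t) * g (suc t) i)) k)
    (cong (a zero * mulXYZ (g zero) k +_) (mulXYZ-sumFin (λ t → a (suc t)) (λ t → g (suc t)) k))

  coeff-linComb : ∀ {N d} (a : Fin d → ℚ) (B : Fin d → Form N) →
    coeff (linComb a B) ≐ (λ i → sumFin (λ t → a t * coeff (B t) i))
  coeff-linComb {N} a B i with i <? suc N
  ... | yes _ = refl
  ... | no  _ = sym (sumFin-zero (λ t → a t * 0ℚ) (λ t → ℚP.*-zeroʳ (a t)))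

  linComb-mulXYZ : ∀ {n d} (a : Fin d → ℚ) (B : Fin d → Form n) j →
    linComb a (λ i → mulXYZᶠ (B i)) j ≡ mulXYZᶠ (linComb a B) j
  linComb-mulXYZ a B j = trans (sym (mulXYZ-sumFin a (λ t → coeff (B t)) (toℕ j)))
                               (mulXYZ-cong (λ i → sym (coeff-linComb a B i)) (toℕ j))

  mulXYZᶠ-cong : ∀ {n} {Q Q′ : Form n} → (∀ j → Q j ≡ Q′ j) → ∀ j → mulXYZᶠ Q j ≡ mulXYZᶠ Q′ j
  mulXYZᶠ-cong Q≡Q′ j = mulXYZ-cong (coeff-cong Q≡Q′) (toℕ j)

  mulXYZᶠ-injective : ∀ {n} (Q : Form n) → (∀ j → mulXYZᶠ Q j ≡ 0ℚ) → ∀ j → Q j ≡ 0ℚ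
  mulXYZᶠ-injective {n} Q XYZQ≡0 j = trans (sym (coeff-toℕ Q j)) (mulXYZ-injective XYZQ≐0 (toℕ j))
    where
    XYZQ≐0 : mulXYZ (coeff Q) ≐ (λ _ → 0ℚ)
    XYZQ≐0 k with k <? suc (3 ℕ.+ n)
    ... | yes k<n+4 = trans (cong (mulXYZ (coeff Q)) (sym (FinP.toℕ-fromℕ< k<n+4))) (XYZQ≡0 (fromℕ< k<n+4))
    ... | no  k≮n+4 = mulXYZ-supported n (coeff Q) (coeff-supported Q) k (ℕP.≮⇒≥ k≮n+4)

  section-HasDim : ∀ n {d} → HasDim (InW n) d → HasDim (Section (InW (3 ℕ.+ n))) d
  section-HasDim n {d} (B , memB , indepB , spanB) = K , mem , indep , span
    where
    K : Fin d → Form (3 ℕ.+ n)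
    K i = mulXYZᶠ (B i)

    mem : ∀ i → Section (InW (3 ℕ.+ n)) (K i)
    mem i = InW-mulXYZ {Q = B i} (memB i) , mulXYZᶠ-top (B i)

    indep : LinIndep K
    indep a comb≡0 = indepB a (mulXYZᶠ-injective (linComb a B) (λ j → trans (sym (linComb-mulXYZ a B j)) (comb≡0 j)))

    span : Spans (Section (InW (3 ℕ.+ n))) K
    span P (wP , lead≡0) = a , λ j → begin
      P j                          ≡⟨ P≡XYZQ j ⟩
      mulXYZᶠ Q j                  ≡⟨ mulXYZᶠ-cong Q≡comb j ⟩
      mulXYZᶠ (linComb a B) j      ≡⟨ sym (linComb-mulXYZ a B j) ⟩
      linComb a K j                ∎
      where
      open ≡-Reasoning
      Q = proj₁ (division n P wP lead≡0)
      P≡XYZQ = proj₂ (division n P wP lead≡0)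
      wQ : InW n Q
      wQ = InW-mulXYZ⁻ {Q = Q} (InW-cong P≡XYZQ wP)
      a = proj₁ (spanB Q wQ)
      Q≡comb = proj₂ (spanB Q wQ)

  -- u m = X^(m+1) - Y^(m+1)  lies in W_(m+1) and has leading coefficient 1.
  uCoeffs : ℕ → Coeffs
  uCoeffs m i = monoX (suc m) i + - 1ℚ * one i

  u : ∀ m → Form (suc m)
  u m = toForm (suc m) (uCoeffs m)

  uCoeffs-supported : ∀ m → Supported (uCoeffs m) (suc m)
  uCoeffs-supported m (suc i) m+1<i+1 = cong (λ z → z + - 1ℚ * 0ℚ) (monoX-supported (suc m) (suc i) m+1<i+1)

  lead-u : ∀ m → lead (u m) ≡ 1ℚ
  lead-u m = trans (cong (uCoeffs m) (FinP.toℕ-fromℕ (suc m))) (cong (λ z → z + - 1ℚ * 0ℚ) (monoX-top (suc m)))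

  image-u : ∀ m s → image (u m) s ≐
    (λ k → pow (linear (α₁ s) (β₁ s)) (suc m) k + - 1ℚ * pow (linear (α₂ s) (β₂ s)) (suc m) k)
  image-u m s k = begin
    substSeq (suc m) (coeff (u m)) k
      ≡⟨ substSeq-cong (suc m) (λ i _ → coeff-toForm (suc m) (uCoeffs m) (uCoeffs-supported m) i) k ⟩
    substSeq (suc m) (λ i → monoX (suc m) i + - 1ℚ * one i) k
      ≡⟨ substSeq-lin (suc m) (monoX (suc m)) one (- 1ℚ) k ⟩
    substSeq (suc m) (monoX (suc m)) k + - 1ℚ * substSeq (suc m) one k
      ≡⟨ cong₂ (λ x y → x + - 1ℚ * y) (substSeq-X^ (suc m) k) (substSeq-Y^ (suc m) k) ⟩
    pow L₁ (suc m) k + - 1ℚ * pow L₂ (suc m) k ∎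
    where
    open ≡-Reasoning
    open Subst s

  -- both relations telescope: (X^M - Y^M) + (Y^M - X^M) = 0 and (X^M - Y^M) + (Y^M - Z^M) + (Z^M - X^M) = 0
  InW-u : ∀ m → InW (suc m) (u m)
  InW-u m = antisym , cyclic
    where
    M = suc m
    antisym : ∀ k → image (u m) σXY k + image (u m) σYX k ≡ 0ℚ
    antisym k = trans (cong₂ _+_ (image-u m σXY k) (image-u m σYX k))
      (solve 2 (λ x y → (x :+ (:- con 1ℚ) :* y) :+ (y :+ (:- con 1ℚ) :* x) := con 0ℚ) refl (pow X M k) (pow Y M k))
    cyclic : ∀ k → image (u m) σXY k + image (u m) σYZ k + image (u m) σZX k ≡ 0ℚ
    cyclic k = trans (cong₂ _+_ (cong₂ _+_ (image-u m σXY k) (image-u m σYZ k)) (image-u m σZX k))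
      (solve 3 (λ x y z → (x :+ (:- con 1ℚ) :* y) :+ (y :+ (:- con 1ℚ) :* z) :+ (z :+ (:- con 1ℚ) :* x) := con 0ℚ)
             refl (pow X M k) (pow Y M k) (pow XY⁻ M k))

  W₀-trivial : ∀ P → InW 0 P → ∀ j → P j ≡ 0ℚ
  W₀-trivial P w = coeff-vanish P λ { zero z≤n → half (antisym-bottom P w) }
    where
    half : ∀ {x} → x + x ≡ 0ℚ → x ≡ 0ℚ
    half {x} x+x≡0 = trans (solve 1 (λ x → x := con ½ :* (x :+ x)) refl x) (trans (cong (½ *_) x+x≡0) (ℚP.*-zeroʳ ½))

  section₁-trivial : ∀ P → Section (InW 1) P → ∀ j → P j ≡ 0ℚ
  section₁-trivial P (w , lead≡0) = coeff-vanish P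
    λ { zero _ → proj₁ (vanishing P w p₁≡0) ; (suc zero) _ → p₁≡0 ; (suc (suc _)) (s≤s ()) }
    where
    p₁≡0 : coeff P 1 ≡ 0ℚ
    p₁≡0 = trans (coeff-top P) lead≡0

  section₂-trivial : ∀ P → Section (InW 2) P → ∀ j → P j ≡ 0ℚ
  section₂-trivial P (w , lead≡0) = coeff-vanish P
    λ { zero _ → p₀≡0 ; (suc zero) _ → p₁≡0 ; (suc (suc zero)) _ → p₂≡0 ; (suc (suc (suc _))) (s≤s (s≤s ())) }
    where
    p₂≡0 : coeff P 2 ≡ 0ℚ
    p₂≡0 = trans (coeff-top P) lead≡0
    p₀≡0 : coeff P 0 ≡ 0ℚ
    p₀≡0 = proj₁ (vanishing P w p₂≡0)
    -- P(1,-1) = p₀ - p₁ + p₂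
    p₁≡0 : coeff P 1 ≡ 0ℚ
    p₁≡0 = trans (solve 3 (λ a b c → b := :- (con 1ℚ :* a :+ ((:- con 1ℚ) :* b :+ (con 1ℚ :* c :+ con 0ℚ))) :+ a :+ c)
                         refl (coeff P 0) (coeff P 1) (coeff P 2))
                 (cong₂ _+_ (cong₂ (λ x y → - x + y) (proj₂ (vanishing P w p₂≡0)) p₀≡0) p₂≡0)

  dimW : ℕ → ℕ
  dimW 0                     = 0
  dimW 1                     = 1
  dimW 2                     = 1
  dimW (suc (suc (suc n)))   = suc (dimW n)

  W-HasDim : ∀ N → HasDim (InW N) (dimW N)
  W-HasDim 0                   = HasDim-zero W₀-trivial
  W-HasDim 1                   = HasDim-extend (InW 1) (u 0) InW-lin (InW-u 0) (lead-u 0) (HasDim-zero section₁-trivial)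
  W-HasDim 2                   = HasDim-extend (InW 2) (u 1) InW-lin (InW-u 1) (lead-u 1) (HasDim-zero section₂-trivial)
  W-HasDim (suc (suc (suc n))) = HasDim-extend (InW (3 ℕ.+ n)) (u (2 ℕ.+ n)) InW-lin (InW-u (2 ℕ.+ n)) (lead-u (2 ℕ.+ n))
                                                (section-HasDim n (W-HasDim n))

  dimW-formula : ∀ N → dimW N ≡ (N ℕ.+ 2) ℕ./ 3
  dimW-formula 0                   = refl
  dimW-formula 1                   = refl
  dimW-formula 2                   = refl
  dimW-formula (suc (suc (suc n))) =
    trans (cong suc (dimW-formula n)) (sym (ℕDivMod.m/n≡1+[m∸n]/n {suc (suc (suc n)) ℕ.+ 2} {3} (s≤s (s≤s (s≤s z≤n)))))

open import Data.Nat using (ℕ; _+_; _/_)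
import Relation.Binary.PropositionalEquality as Eq
open DimensionOfW using (W-HasDim; dimW-formula)

mainTheorem7 : (N : ℕ) → HasDim (InW N) ((N + 2) / 3)
mainTheorem7 N = Eq.subst (HasDim (InW N)) (dimW-formula N) (W-HasDim N)
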